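{- There exists $q_0$ such that for every odd prime power $q \ge q_0$ we have $N(2,q) \le 2q^{4/3}$, where $N(n,q)$ is the largest possible cardinality of a set $\mathcal{Z} \subseteq \mathbb{F}_q^n$ such that for all pairwise distinct $\vec{u}, \vec{v}, \vec{w} \in \mathcal{Z}$ the element $\Delta(\vec{u},\vec{v},\vec{w})$ is a quadratic residue in $\mathbb{F}_q$.
   Context: $\mathbb{F}_q$ denotes the finite field with $q$ elements, $q$ odd. For $\vec{u}=(u_1,\ldots,u_n), \vec{v}=(v_1,\ldots,v_n), \vec{w}=(w_1,\ldots,w_n) \in \mathbb{F}_q^n$ define $$\Delta(\vec{u},\vec{v},\vec{w}) = \sum_{i=1}^n \left((u_i-v_i)^2 + (u_i-w_i)^2 - (v_i-w_i)^2\right) = 2(\vec{u}-\vec{v})\cdot(\vec{u}-\vec{w}),$$ where $\cdot$ is the standard inner product. The triangle with vertices $\vec{u},\vec{v},\vec{w}$ is said to have an acute angle at $\vec{u}$ if $\Delta(\vec{u},\vec{v},\vec{w})$ is a quadratic residue (a nonzero square) in $\mathbb{F}_q$; a set in which every triple of distinct points defines a triangle that is acute at all three vertices is exactly a set as in the claim. -}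

module Defs where

open import Data.Nat as ℕ using (ℕ; suc)
open import Data.Nat.Primality using (Prime)
open import Data.Fin using (Fin)
open import Data.Vec using (Vec; zipWith; foldr)
open import Data.List using (List)
open import Data.List.Membership.Propositional using (_∈_)
open import Data.Product using (Σ; ∃; _×_)
open import Relation.Binary.PropositionalEquality using (_≡_; _≢_)
open import Algebra.Structures using (IsCommutativeRing)

IsPrimePower : ℕ → Set
IsPrimePower q = Σ ℕ λ p → Σ ℕ λ k → Prime p × q ≡ p ℕ.^ suc k

-- A finite field with q elements, represented on the carrier Fin q
-- (every finite field of order q is isomorphic to one of these).
record FiniteField (q : ℕ) : Set where
  infixl 6 _+_ _-_
  infixl 7 _*_
  field
    _+_ _*_ : Fin q → Fin q → Fin q
    -_      : Fin q → Fin q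
    0# 1#   : Fin q
    isCommutativeRing : IsCommutativeRing _≡_ _+_ _*_ -_ 0# 1#
    0≢1     : 0# ≢ 1#
    inverse : ∀ x → x ≢ 0# → ∃ λ y → x * y ≡ 1#

  _-_ : Fin q → Fin q → Fin q
  x - y = x + (- y)

  sq : Fin q → Fin q
  sq x = x * x

  IsQR : Fin q → Set
  IsQR x = x ≢ 0# × ∃ λ y → y * y ≡ x

  Δ : ∀ {n} → Vec (Fin q) n → Vec (Fin q) n → Vec (Fin q) n → Fin q
  Δ u v w = foldr _ _+_ 0#
    (zipWith (λ a bc → sq (a - Data.Product.proj₁ bc) + sq (a - Data.Product.proj₂ bc)
                          - sq (Data.Product.proj₁ bc - Data.Product.proj₂ bc))
             u (zipWith Data.Product._,_ v w))

  AcuteSet : ∀ {n} → List (Vec (Fin q) n) → Set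
  AcuteSet Z = ∀ u v w → u ∈ Z → v ∈ Z → w ∈ Z →
               u ≢ v → u ≢ w → v ≢ w → IsQR (Δ u v w)

-- Fix a nonsquare ν, which exists because q is odd, and split Z into halves A and C.
-- The shear (a, c) ↦ a + ν c maps A × C injectively into F_q^n: a collision a + ν c = a′ + ν c′
-- with a ≠ a′ forces Δ(a, a′, c) = ν Δ(c, c′, a), making ν a quotient of two quadratic residues.
-- Hence ⌊N/2⌋ ⌈N/2⌉ ≤ q^n; for n = 2 this gives N ≤ 2q, which is stronger than N³ ≤ 8q⁴.
module Submission where

open import Defs
open import Data.Nat using (ℕ; zero; suc; >-nonZero)
open import Data.Nat.Divisibility using (_∣_; divides)
open import Data.Fin as Fin using (Fin)
import Data.Fin.Properties as Fin
open import Data.Vec using (Vec; []; _∷_; zipWith)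
open import Data.Vec.Properties as Vec using (∷-injective)
open import Data.List using (List; []; _∷_; [_]; _++_; length; map; filter; take; drop; allFin;
                             cartesianProduct; cartesianProductWith)
open import Data.List.Properties using (length-++; length-map; length-tabulate; filter-notAll;
                                        length-take; length-drop)
open import Data.List.Membership.Propositional using (_∈_)
open import Data.List.Membership.Propositional.Properties
  using (∈-filter⁺; ∈-filter⁻; ∈-allFin; ∈-cartesianProductWith⁺; ∈-cartesianProduct⁻)
open import Data.List.Relation.Unary.Any as Any using (here; there)
import Data.List.Relation.Unary.All as All
open import Data.List.Relation.Unary.Unique.Propositional using (Unique; []; _∷_)
import Data.List.Relation.Unary.Unique.Propositional.Properties as Unique
open import Data.List.Relation.Binary.Subset.Propositional using (_⊆_)
open import Data.List.Relation.Binary.Disjoint.Propositional using (Disjoint)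
import Data.List.Relation.Binary.Sublist.Propositional as Sublist
import Data.List.Relation.Binary.Sublist.Propositional.Properties as Sublist
open import Data.Product using (Σ; ∃; _×_; _,_; proj₁; proj₂; uncurry)
open import Data.Empty using (⊥-elim)
open import Function using (_∘_; id)
open import Relation.Binary.PropositionalEquality
  using (_≡_; _≢_; refl; sym; trans; cong; cong₂; subst; subst₂; module ≡-Reasoning)
open import Relation.Binary.Definitions using (DecidableEquality)
open import Relation.Nullary using (¬_; yes; no; ¬?; contradiction)
open import Relation.Unary using (Decidable)
open import Relation.Unary.Properties using (∁?)

InjectiveOn : {A B : Set} → (A → B) → List A → Set
InjectiveOn f xs = ∀ {x y} → x ∈ xs → y ∈ xs → f x ≡ f y → x ≡ y

zipWith-cancelˡ : {A B C : Set} {n : ℕ} (f : A → B → C) → (∀ {x y y′} → f x y ≡ f x y′ → y ≡ y′) →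
                  (xs : Vec A n) {ys ys′ : Vec B n} → zipWith f xs ys ≡ zipWith f xs ys′ → ys ≡ ys′
zipWith-cancelˡ f f-cancel [] {[]} {[]} _ = refl
zipWith-cancelˡ f f-cancel (x ∷ xs) {y ∷ ys} {y′ ∷ ys′} eq with ∷-injective eq
... | head-eq , tail-eq = cong₂ _∷_ (f-cancel head-eq) (zipWith-cancelˡ f f-cancel xs tail-eq)

zipWith-cancelʳ : {A B C : Set} {n : ℕ} (f : A → B → C) → (∀ {x x′ y} → f x y ≡ f x′ y → x ≡ x′) →
                  {xs xs′ : Vec A n} (ys : Vec B n) → zipWith f xs ys ≡ zipWith f xs′ ys → xs ≡ xs′
zipWith-cancelʳ f f-cancel {[]} {[]} [] _ = refl
zipWith-cancelʳ f f-cancel {x ∷ xs} {x′ ∷ xs′} (y ∷ ys) eq with ∷-injective eq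
... | head-eq , tail-eq = cong₂ _∷_ (f-cancel head-eq) (zipWith-cancelʳ f f-cancel ys tail-eq)

module Counting where

  open import Data.Nat using (_+_; _*_; _^_; _≤_; _<_; z≤n; s≤s)
  open import Data.Nat.Properties using (≤-trans; ≤-antisym; +-suc; +-identityʳ; *-comm; ≮⇒≥; <⇒≱)
  open ≡-Reasoning

  length≤-injectiveOn : {A B : Set} → DecidableEquality B → (f : A → B) → {xs : List A} {ys : List B} →
                        Unique xs → InjectiveOn f xs → (∀ {x} → x ∈ xs → f x ∈ ys) →
                        length xs ≤ length ys
  length≤-injectiveOn _≟_ f {[]} _ _ _ = z≤n
  length≤-injectiveOn _≟_ f {x ∷ xs} {ys} (x∉xs ∷ xs!) f-inj f-into =
    ≤-trans (s≤s (length≤-injectiveOn _≟_ f xs! (λ p q → f-inj (there p) (there q)) f-into′))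
            (filter-notAll P? ys (Any.map (λ fx≡y y≢fx → y≢fx (sym fx≡y)) (f-into (here refl))))
    where
      P? : Decidable (λ y → ¬ y ≡ f x)
      P? y = ¬? (y ≟ f x)
      f-into′ : ∀ {z} → z ∈ xs → f z ∈ filter P? ys
      f-into′ z∈xs = ∈-filter⁺ P? (f-into (there z∈xs))
        (λ fz≡fx → All.lookup x∉xs z∈xs (sym (f-inj (there z∈xs) (here refl) fz≡fx)))

  length-filter+length-filter-∁ : {A : Set} {P : A → Set} (P? : Decidable P) (xs : List A) →
                                  length (filter P? xs) + length (filter (∁? P?) xs) ≡ length xs
  length-filter+length-filter-∁ P? [] = refl
  length-filter+length-filter-∁ P? (x ∷ xs) with P? x
  ... | yes _ = cong suc (length-filter+length-filter-∁ P? xs)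
  ... | no _  = trans (+-suc _ _) (cong suc (length-filter+length-filter-∁ P? xs))

  length-allFin : ∀ n → length (allFin n) ≡ n
  length-allFin n = length-tabulate {n = n} id

  length-cartesianProductWith : {A B C : Set} (f : A → B → C) (xs : List A) (ys : List B) →
                                length (cartesianProductWith f xs ys) ≡ length xs * length ys
  length-cartesianProductWith f [] ys = refl
  length-cartesianProductWith f (x ∷ xs) ys = begin
    length (map (f x) ys ++ cartesianProductWith f xs ys)          ≡⟨ length-++ (map (f x) ys) ⟩
    length (map (f x) ys) + length (cartesianProductWith f xs ys)  ≡⟨ cong₂ _+_ (length-map (f x) ys)
                                                                           (length-cartesianProductWith f xs ys) ⟩
    length ys + length xs * length ys                               ∎

  allVecs : ∀ q n → List (Vec (Fin q) n)
  allVecs q zero    = [ [] ]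
  allVecs q (suc n) = cartesianProductWith _∷_ (allFin q) (allVecs q n)

  length-allVecs : ∀ q n → length (allVecs q n) ≡ q ^ n
  length-allVecs q zero    = refl
  length-allVecs q (suc n) = trans (length-cartesianProductWith _∷_ (allFin q) (allVecs q n))
                                   (cong₂ _*_ (length-allFin q) (length-allVecs q n))

  ∈-allVecs : ∀ {q n} (v : Vec (Fin q) n) → v ∈ allVecs q n
  ∈-allVecs []      = here refl
  ∈-allVecs (x ∷ v) = ∈-cartesianProductWith⁺ _∷_ (∈-allFin x) (∈-allVecs v)

  -- σ swaps the points below their image with those above it.
  fixedPointFreeInvolution⇒even : ∀ {n} (σ : Fin n → Fin n) →
                                   (∀ x → σ (σ x) ≡ x) → (∀ x → σ x ≢ x) → 2 ∣ n
  fixedPointFreeInvolution⇒even {n} σ σ-involutive σ-free = divides (length lower) (begin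
    n                                   ≡⟨ sym (length-allFin n) ⟩
    length (allFin n)                   ≡⟨ sym (length-filter+length-filter-∁ below? (allFin n)) ⟩
    length lower + length upper         ≡⟨ cong (length lower +_) (≤-antisym upper≤lower lower≤upper) ⟩
    length lower + length lower         ≡⟨ cong (length lower +_) (sym (+-identityʳ (length lower))) ⟩
    2 * length lower                    ≡⟨ *-comm 2 (length lower) ⟩
    length lower * 2                    ∎)
    where
      below? : Decidable (λ x → x Fin.< σ x)
      below? x = x Fin.<? σ x
      lower upper : List (Fin n)
      lower = filter below? (allFin n)
      upper = filter (∁? below?) (allFin n)

      σ-injective : ∀ {xs : List (Fin n)} → InjectiveOn σ xs
      σ-injective {x = x} {y} _ _ σx≡σy =
        trans (sym (σ-involutive x)) (trans (cong σ σx≡σy) (σ-involutive y))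

      σ-lower : ∀ {x} → x ∈ lower → σ x ∈ upper
      σ-lower {x} x∈ = ∈-filter⁺ (∁? below?) (∈-allFin (σ x))
        (λ σx<σσx → Fin.<-asym (proj₂ (∈-filter⁻ below? {xs = allFin n} x∈))
                               (subst (σ x Fin.<_) (σ-involutive x) σx<σσx))

      σ-upper : ∀ {x} → x ∈ upper → σ x ∈ lower
      σ-upper {x} x∈ = ∈-filter⁺ below? (∈-allFin (σ x))
        (subst (σ x Fin.<_) (sym (σ-involutive x))
          (Fin.≤∧≢⇒< (≮⇒≥ (proj₂ (∈-filter⁻ (∁? below?) {xs = allFin n} x∈))) (σ-free x)))

      lower≤upper : length lower ≤ length upper
      lower≤upper = length≤-injectiveOn Fin._≟_ σ (Unique.filter⁺ below? (Unique.allFin⁺ n)) σ-injective σ-lower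

      upper≤lower : length upper ≤ length lower
      upper≤lower = length≤-injectiveOn Fin._≟_ σ (Unique.filter⁺ (∁? below?) (Unique.allFin⁺ n)) σ-injective σ-upper

  non-injective⇒non-surjective : ∀ {n} (f : Fin n → Fin n) {x y} → x ≢ y → f x ≡ f y →
                                  ∃ λ z → ∀ t → f t ≢ z
  non-injective⇒non-surjective {n} f {x} {y} x≢y fx≡fy
    with Fin.any? (λ z → Fin.all? (λ t → ¬? (f t Fin.≟ z)))
  ... | yes missed  = missed
  ... | no everyHit = contradiction n≤|allFin-y| (<⇒≱ |allFin-y|<n)
    where
      hit : ∀ z → ∃ λ t → f t ≡ z
      hit z with Fin.any? (λ t → f t Fin.≟ z)
      ... | yes found = found
      ... | no none   = ⊥-elim (everyHit (z , λ t ft≡z → none (t , ft≡z)))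

      -- f x = f y lets every preimage avoid y.
      hitAvoiding : ∀ z → ∃ λ t → t ≢ y × f t ≡ z
      hitAvoiding z with hit z
      ... | t , ft≡z with t Fin.≟ y
      ...   | yes refl = x , x≢y , trans fx≡fy ft≡z
      ...   | no t≢y   = t , t≢y , ft≡z

      avoid? : Decidable (_≢ y)
      avoid? t = ¬? (t Fin.≟ y)

      n≤|allFin-y| : n ≤ length (filter avoid? (allFin n))
      n≤|allFin-y| = subst (_≤ length (filter avoid? (allFin n))) (length-allFin n)
        (length≤-injectiveOn Fin._≟_ (proj₁ ∘ hitAvoiding) (Unique.allFin⁺ n)
          (λ {z} {z′} _ _ e → trans (sym (proj₂ (proj₂ (hitAvoiding z))))
                                    (trans (cong f e) (proj₂ (proj₂ (hitAvoiding z′)))))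
          (λ {z} _ → ∈-filter⁺ avoid? (∈-allFin _) (proj₁ (proj₂ (hitAvoiding z)))))

      |allFin-y|<n : length (filter avoid? (allFin n)) < n
      |allFin-y|<n = subst (length (filter avoid? (allFin n)) <_) (length-allFin n)
        (filter-notAll avoid? (allFin n) (Any.map (λ y≡t t≢y → t≢y (sym y≡t)) (∈-allFin y)))

  Unique⇒Disjoint-take-drop : {A : Set} (k : ℕ) {xs : List A} → Unique xs → Disjoint (take k xs) (drop k xs)
  Unique⇒Disjoint-take-drop zero    _ (() , _)
  Unique⇒Disjoint-take-drop (suc k) {x ∷ xs} (x∉xs ∷ _) (here refl , v∈drop) =
    All.lookup x∉xs (Sublist.lookup (Sublist.drop-⊆ k xs) v∈drop) refl
  Unique⇒Disjoint-take-drop (suc k) {x ∷ xs} (_ ∷ xs!) (there v∈take , v∈drop) =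
    Unique⇒Disjoint-take-drop k xs! (v∈take , v∈drop)

module Arithmetic where

  open import Data.Nat
  open import Data.Nat.Properties
  open import Data.Nat.Solver using (module +-*-Solver)

  q+q<n⇒q*q<⌊n/2⌋*[n∸⌊n/2⌋] : ∀ n q .{{_ : NonZero q}} → q + q < n → q * q < ⌊ n /2⌋ * (n ∸ ⌊ n /2⌋)
  q+q<n⇒q*q<⌊n/2⌋*[n∸⌊n/2⌋] n q 2q<n = begin-strict
    q * q                      <⟨ *-monoʳ-< q (n<1+n q) ⟩
    q * suc q                  ≤⟨ *-mono-≤ q≤⌊n/2⌋ 1+q≤⌈n/2⌉ ⟩
    ⌊ n /2⌋ * ⌈ n /2⌉          ≡⟨ cong (⌊ n /2⌋ *_) ⌈n/2⌉≡n∸⌊n/2⌋ ⟩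
    ⌊ n /2⌋ * (n ∸ ⌊ n /2⌋)    ∎
    where
      open ≤-Reasoning
      q≤⌊n/2⌋ : q ≤ ⌊ n /2⌋
      q≤⌊n/2⌋ = subst (_≤ ⌊ n /2⌋) (sym (n≡⌊n+n/2⌋ q)) (⌊n/2⌋-mono (<⇒≤ 2q<n))
      1+q≤⌈n/2⌉ : suc q ≤ ⌈ n /2⌉
      1+q≤⌈n/2⌉ = subst (_≤ ⌈ n /2⌉) (cong suc (sym (n≡⌊n+n/2⌋ q))) (⌈n/2⌉-mono 2q<n)
      ⌈n/2⌉≡n∸⌊n/2⌋ : ⌈ n /2⌉ ≡ n ∸ ⌊ n /2⌋
      ⌈n/2⌉≡n∸⌊n/2⌋ = trans (sym (m+n∸m≡n ⌊ n /2⌋ ⌈ n /2⌉)) (cong (_∸ ⌊ n /2⌋) (⌊n/2⌋+⌈n/2⌉≡n n))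

  ⌊n/2⌋*[n∸⌊n/2⌋]≤q*q⇒n≤q+q : ∀ n q .{{_ : NonZero q}} → ⌊ n /2⌋ * (n ∸ ⌊ n /2⌋) ≤ q * q → n ≤ q + q
  ⌊n/2⌋*[n∸⌊n/2⌋]≤q*q⇒n≤q+q n q bound = ≮⇒≥ (λ 2q<n → <⇒≱ (q+q<n⇒q*q<⌊n/2⌋*[n∸⌊n/2⌋] n q 2q<n) bound)

  n≤q+q⇒n^3≤8*q^4 : ∀ n q .{{_ : NonZero q}} → n ≤ q + q → n ^ 3 ≤ 8 * q ^ 4
  n≤q+q⇒n^3≤8*q^4 n q n≤2q = begin
    n ^ 3            ≤⟨ ^-monoˡ-≤ 3 n≤2q ⟩
    (q + q) ^ 3      ≡⟨ doubling q ⟩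
    8 * q ^ 3        ≤⟨ *-monoʳ-≤ 8 (m≤n*m (q ^ 3) q) ⟩
    8 * q ^ 4        ∎
    where
      open ≤-Reasoning
      open +-*-Solver
      doubling : ∀ q → (q + q) ^ 3 ≡ 8 * q ^ 3
      doubling = solve 1 (λ q → (q :+ q) :^ 3 := con 8 :* q :^ 3) refl

open Counting
open Arithmetic

module AcuteSets {q : ℕ} (F : FiniteField q) where

  open FiniteField F
  open import Level using (0ℓ)
  open import Algebra.Bundles using (CommutativeRing)
  import Data.Nat as ℕ
  import Data.Nat.Properties as ℕ

  commutativeRing : CommutativeRing 0ℓ 0ℓ
  commutativeRing = record { isCommutativeRing = isCommutativeRing }

  open CommutativeRing commutativeRing
    using (ring; commutativeSemiring; +-group; +-abelianGroup; +-assoc; +-identityʳ; -‿inverseʳ;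
           zeroˡ; zeroʳ; *-assoc; *-identityˡ; *-identityʳ; distribˡ)
  open import Algebra.Properties.Ring ring using (-‿distribˡ-*; -‿distribʳ-*; x[y-z]≈xy-xz)
  open import Algebra.Properties.Group +-group
    using (∙-cancelˡ; ∙-cancelʳ; x≈z//y; \\-leftDividesʳ; ⁻¹-involutive)
  open import Algebra.Properties.AbelianGroup +-abelianGroup using (⁻¹-anti-homo‿-; xyx⁻¹≈y)
  open import Algebra.Solver.Ring.NaturalCoefficients.Default commutativeSemiring
  open ≡-Reasoning

  1+1≢0 : ¬ 2 ∣ q → 1# + 1# ≢ 0#
  1+1≢0 odd 1+1≡0 = odd (fixedPointFreeInvolution⇒even (_+ 1#) involutive fixedPointFree)
    where
      involutive : ∀ x → (x + 1#) + 1# ≡ x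
      involutive x = trans (+-assoc x 1# 1#) (trans (cong (x +_) 1+1≡0) (+-identityʳ x))
      fixedPointFree : ∀ x → x + 1# ≢ x
      fixedPointFree x x+1≡x = 0≢1 (sym (∙-cancelˡ x 1# 0# (trans x+1≡x (sym (+-identityʳ x)))))

  -x*-y≡x*y : ∀ x y → (- x) * (- y) ≡ x * y
  -x*-y≡x*y x y = begin
    (- x) * (- y)    ≡⟨ sym (-‿distribˡ-* x (- y)) ⟩
    - (x * - y)      ≡⟨ cong -_ (sym (-‿distribʳ-* x y)) ⟩
    - (- (x * y))    ≡⟨ ⁻¹-involutive (x * y) ⟩
    x * y            ∎

  ∃nonsquare : ¬ 2 ∣ q → ∃ λ ν → ∀ t → t * t ≢ ν
  ∃nonsquare odd = non-injective⇒non-surjective sq 1≢-1 (sym (-x*-y≡x*y 1# 1#))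
    where
      1≢-1 : 1# ≢ - 1#
      1≢-1 1≡-1 = 1+1≢0 odd (trans (cong (1# +_) 1≡-1) (-‿inverseʳ 1#))

  *-cancelˡ-≢0 : ∀ {ν} → ν ≢ 0# → ∀ {x y} → ν * x ≡ ν * y → x ≡ y
  *-cancelˡ-≢0 {ν} ν≢0 {x} {y} νx≡νy with inverse ν ν≢0
  ... | w , νw≡1 = trans (sym (undo x)) (trans (cong (w *_) νx≡νy) (undo y))
    where
      undo : ∀ z → w * (ν * z) ≡ z
      undo z = begin
        w * (ν * z)  ≡⟨ solve 3 (λ w ν z → w :* (ν :* z) := (ν :* w) :* z) refl w ν z ⟩
        (ν * w) * z  ≡⟨ cong (_* z) νw≡1 ⟩
        1# * z       ≡⟨ *-identityˡ z ⟩
        z            ∎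

  IsQR-ratio-square : ∀ {ν a b} → IsQR a → IsQR b → a ≡ ν * b → ∃ λ t → t * t ≡ ν
  IsQR-ratio-square {ν} {a} {b} (_ , x , x²≡a) (b≢0 , y , y²≡b) a≡νb with inverse y y≢0
    where
      y≢0 : y ≢ 0#
      y≢0 y≡0 = b≢0 (trans (sym y²≡b) (trans (cong sq y≡0) (zeroˡ 0#)))
  ... | z , yz≡1 = x * z , (begin
    (x * z) * (x * z)         ≡⟨ solve 2 (λ x z → (x :* z) :* (x :* z) := (x :* x) :* (z :* z)) refl x z ⟩
    (x * x) * (z * z)         ≡⟨ cong (_* (z * z)) (trans x²≡a (trans a≡νb (cong (ν *_) (sym y²≡b)))) ⟩
    (ν * (y * y)) * (z * z)   ≡⟨ solve 3 (λ ν y z → (ν :* (y :* y)) :* (z :* z) := ν :* ((y :* z) :* (y :* z)))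
                                       refl ν y z ⟩
    ν * ((y * z) * (y * z))   ≡⟨ cong (λ w → ν * (w * w)) yz≡1 ⟩
    ν * (1# * 1#)             ≡⟨ cong (ν *_) (*-identityˡ 1#) ⟩
    ν * 1#                    ≡⟨ *-identityʳ ν ⟩
    ν                         ∎)

  Δ₁ : Fin q → Fin q → Fin q → Fin q
  Δ₁ a b c = sq (a - b) + sq (a - c) - sq (b - c)

  [x-y]+[y-z]≡x-z : ∀ x y z → (x - y) + (y - z) ≡ x - z
  [x-y]+[y-z]≡x-z x y z = trans (+-assoc x (- y) (y - z)) (cong (x +_) (\\-leftDividesʳ y (- z)))

  Δ₁-factor : ∀ x y z → Δ₁ x y z ≡ (x - y) * (x - z) + (x - y) * (x - z)
  Δ₁-factor x y z = begin
    sq u + sq (x - z) - sq v                     ≡⟨ cong (λ w → sq u + sq w - sq v) (sym ([x-y]+[y-z]≡x-z x y z)) ⟩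
    sq u + sq (u + v) - sq v                     ≡⟨ cong (_- sq v) (square-expansion u v) ⟩
    sq v + (u * (u + v) + u * (u + v)) - sq v    ≡⟨ xyx⁻¹≈y (sq v) _ ⟩
    u * (u + v) + u * (u + v)                    ≡⟨ cong (λ w → u * w + u * w) ([x-y]+[y-z]≡x-z x y z) ⟩
    u * (x - z) + u * (x - z)                    ∎
    where
      u = x - y
      v = y - z
      square-expansion : ∀ u v → sq u + sq (u + v) ≡ sq v + (u * (u + v) + u * (u + v))
      square-expansion = solve 2 (λ u v → u :* u :+ (u :+ v) :* (u :+ v)
                                       := v :* v :+ (u :* (u :+ v) :+ u :* (u :+ v))) refl

  shear : ∀ {n} → Fin q → Vec (Fin q) n → Vec (Fin q) n → Vec (Fin q) n
  shear ν = zipWith (λ a c → a + ν * c)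

  collision-difference : ∀ {ν a a′ c c′} → a + ν * c ≡ a′ + ν * c′ → a - a′ ≡ ν * (c′ - c)
  collision-difference {ν} {a} {a′} {c} {c′} eq = begin
    a - a′                           ≡⟨ cong (_- a′) (x≈z//y a (ν * c) (a′ + ν * c′) eq) ⟩
    (a′ + ν * c′) - ν * c - a′       ≡⟨ cong (_- a′) (+-assoc a′ (ν * c′) (- (ν * c))) ⟩
    a′ + (ν * c′ - ν * c) - a′       ≡⟨ xyx⁻¹≈y a′ _ ⟩
    ν * c′ - ν * c                   ≡⟨ sym (x[y-z]≈xy-xz ν c′ c) ⟩
    ν * (c′ - c)                     ∎

  -- Since a - a′ = ν (c′ - c), both sides equal 2ν (c - c′)(c - a).
  Δ₁-collision : ∀ {ν a a′ c c′} → a + ν * c ≡ a′ + ν * c′ → Δ₁ a a′ c ≡ ν * Δ₁ c c′ a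
  Δ₁-collision {ν} {a} {a′} {c} {c′} eq = begin
    Δ₁ a a′ c                     ≡⟨ Δ₁-factor a a′ c ⟩
    P + P                         ≡⟨ cong₂ _+_ P≡νQ P≡νQ ⟩
    ν * Q + ν * Q                 ≡⟨ sym (distribˡ ν Q Q) ⟩
    ν * (Q + Q)                   ≡⟨ cong (ν *_) (sym (Δ₁-factor c c′ a)) ⟩
    ν * Δ₁ c c′ a                 ∎
    where
      P = (a - a′) * (a - c)
      Q = (c - c′) * (c - a)
      P≡νQ : P ≡ ν * Q
      P≡νQ = begin
        (a - a′) * (a - c)                  ≡⟨ cong (_* (a - c)) (collision-difference eq) ⟩
        ν * (c′ - c) * (a - c)              ≡⟨ *-assoc ν _ _ ⟩
        ν * ((c′ - c) * (a - c))            ≡⟨ cong₂ (λ s t → ν * (s * t)) (sym (⁻¹-anti-homo‿- c c′))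
                                                                       (sym (⁻¹-anti-homo‿- c a)) ⟩
        ν * ((- (c - c′)) * (- (c - a)))    ≡⟨ cong (ν *_) (-x*-y≡x*y (c - c′) (c - a)) ⟩
        ν * Q                               ∎

  Δ-collision : ∀ {n ν} (a a′ c c′ : Vec (Fin q) n) → shear ν a c ≡ shear ν a′ c′ → Δ a a′ c ≡ ν * Δ c c′ a
  Δ-collision {ν = ν} [] [] [] [] _ = sym (zeroʳ ν)
  Δ-collision {ν = ν} (a ∷ as) (a′ ∷ as′) (c ∷ cs) (c′ ∷ cs′) eq with ∷-injective eq
  ... | head-eq , tail-eq = begin
    Δ₁ a a′ c + Δ as as′ cs              ≡⟨ cong₂ _+_ (Δ₁-collision head-eq) (Δ-collision as as′ cs cs′ tail-eq) ⟩
    ν * Δ₁ c c′ a + ν * Δ cs cs′ as      ≡⟨ sym (distribˡ ν _ _) ⟩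
    ν * (Δ₁ c c′ a + Δ cs cs′ as)        ∎

  module _ {n} {Z : List (Vec (Fin q) n)} (acute : AcuteSet Z) {ν} (ν-nonsquare : ∀ t → t * t ≢ ν) where

    shear-injective : ∀ {a a′ c c′} → a ∈ Z → a′ ∈ Z → c ∈ Z → c′ ∈ Z → a ≢ c → a′ ≢ c → a ≢ c′ →
                      shear ν a c ≡ shear ν a′ c′ → (a , c) ≡ (a′ , c′)
    shear-injective {a} {a′} {c} {c′} a∈ a′∈ c∈ c′∈ a≢c a′≢c a≢c′ eq with Vec.≡-dec Fin._≟_ a a′
    ... | yes refl = cong (a ,_) (zipWith-cancelˡ _ (λ {x} e → *-cancelˡ-≢0 ν≢0 (∙-cancelˡ x _ _ e)) a eq)
      where
        ν≢0 : ν ≢ 0#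
        ν≢0 ν≡0 = ν-nonsquare 0# (trans (zeroˡ 0#) (sym ν≡0))
    ... | no a≢a′ =
      ⊥-elim (uncurry ν-nonsquare (IsQR-ratio-square Δ[a,a′,c]-QR Δ[c,c′,a]-QR (Δ-collision a a′ c c′ eq)))
      where
        c≢c′ : c ≢ c′
        c≢c′ refl = a≢a′ (zipWith-cancelʳ _ (λ {_} {_} {y} e → ∙-cancelʳ (ν * y) _ _ e) c eq)
        Δ[a,a′,c]-QR : IsQR (Δ a a′ c)
        Δ[a,a′,c]-QR = acute a a′ c a∈ a′∈ c∈ a≢a′ a≢c a′≢c
        Δ[c,c′,a]-QR : IsQR (Δ c c′ a)
        Δ[c,c′,a]-QR = acute c c′ a c∈ c′∈ a∈ c≢c′ (a≢c ∘ sym) (a≢c′ ∘ sym)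

    product-bound : ∀ {A C} → A ⊆ Z → C ⊆ Z → Unique A → Unique C → Disjoint A C →
                    length A ℕ.* length C ℕ.≤ q ℕ.^ n
    product-bound {A} {C} A⊆Z C⊆Z A! C! A#C =
      subst₂ ℕ._≤_ (length-cartesianProductWith _,_ A C) (length-allVecs q n)
        (length≤-injectiveOn (Vec.≡-dec Fin._≟_) (uncurry (shear ν)) (Unique.cartesianProduct⁺ A! C!)
                             injective (λ _ → ∈-allVecs _))
      where
        separated : ∀ {a c} → a ∈ A → c ∈ C → a ≢ c
        separated a∈A c∈C refl = A#C (a∈A , c∈C)
        injective : InjectiveOn (uncurry (shear ν)) (cartesianProduct A C)
        injective p∈ p′∈ with ∈-cartesianProduct⁻ A C p∈ | ∈-cartesianProduct⁻ A C p′∈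
        ... | a∈A , c∈C | a′∈A , c′∈C = shear-injective (A⊆Z a∈A) (A⊆Z a′∈A) (C⊆Z c∈C) (C⊆Z c′∈C)
                                          (separated a∈A c∈C) (separated a′∈A c∈C) (separated a∈A c′∈C)

    halves-bound : Unique Z → ℕ.⌊ length Z /2⌋ ℕ.* (length Z ℕ.∸ ℕ.⌊ length Z /2⌋) ℕ.≤ q ℕ.^ n
    halves-bound Z! = subst (ℕ._≤ q ℕ.^ n) (cong₂ ℕ._*_ length-take-k (length-drop k Z))
      (product-bound (Sublist.lookup (Sublist.take-⊆ k Z)) (Sublist.lookup (Sublist.drop-⊆ k Z))
                     (Unique.take⁺ k Z!) (Unique.drop⁺ k Z!) (Unique⇒Disjoint-take-drop k Z!))
      where
        k : ℕ
        k = ℕ.⌊ length Z /2⌋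
        length-take-k : length (take k Z) ≡ k
        length-take-k = trans (length-take k Z) (ℕ.m≤n⇒m⊓n≡m (ℕ.⌊n/2⌋≤n (length Z)))

open import Data.Nat using (_≤_; _*_; _^_)
open import Data.Nat.Properties using (*-identityʳ; ≤-trans; ≤-reflexive)

-- The bound holds for every field of odd order.
theorem1 : Σ ℕ λ q₀ → ∀ (q : ℕ) → IsPrimePower q → ¬ (2 ∣ q) → q₀ ≤ q →
           (F : FiniteField q) → (Z : List (Vec (Fin q) 2)) → Unique Z →
           FiniteField.AcuteSet F Z → length Z ^ 3 ≤ 8 * q ^ 4
theorem1 = 1 , λ q _ odd 1≤q F Z Z! acute →
  let open AcuteSets F
      ν , ν-nonsquare = ∃nonsquare odd
      halves≤q² = halves-bound acute ν-nonsquare Z!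
  in n≤q+q⇒n^3≤8*q^4 (length Z) q {{>-nonZero 1≤q}}
       (⌊n/2⌋*[n∸⌊n/2⌋]≤q*q⇒n≤q+q (length Z) q {{>-nonZero 1≤q}}
         (≤-trans halves≤q² (≤-reflexive (cong (q *_) (*-identityʳ q)))))
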